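{- For any $n\geq2$, $N_{1,n}=N_{3,n-1}\times N_{3,n-1}$, as subgroups of $W_n$.
   Context: $T$ is the infinite rooted binary tree of finite words over $\{1,2\}$, $T_n$ the words of length $\le n$, $W=\mathrm{Aut}(T)$, $W_n=\mathrm{Aut}(T_n)$, $\pi_n:W\to W_n$ restriction. For automorphisms $u,v$ of $T_{n-1}$, $(u,v)\in W_n$ acts by $1w\mapsto1u(w)$, $2w\mapsto2v(w)$; this embeds $W_{n-1}\times W_{n-1}$ into $W_n$ (similarly $W\times W$ into $W$). $\sigma$ swaps the first letter; $(u,v)\sigma=(u,v)\circ\sigma$. $a_1,a_2,a_3\in W$ are defined by $a_1=(\mathrm{id},a_3)$, $a_2=(\mathrm{id},a_1)\sigma$, $a_3=(a_2,\mathrm{id})\sigma$; $G$ is the closed subgroup they generate. $N_i$ is the normal closure in $G$ of the subgroup generated by $a_i$, and $N_{i,n}=\pi_n(N_i)$. -}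

module Defs where

open import Data.Bool using (Bool; true; false; _xor_; if_then_else_)
open import Data.List using (List; []; _∷_)
open import Data.Nat using (ℕ; zero; suc)
open import Data.Unit using (⊤; tt)
open import Data.Product using (Σ; _×_; _,_)
open import Relation.Binary.PropositionalEquality using (_≡_)

-- Letters {1,2} and words (vertices of the rooted binary tree T).
data Letter : Set where
  l1 l2 : Letter

Word : Set
Word = List Letter

flipIf : Bool → Letter → Letter
flipIf false x = x
flipIf true l1 = l2
flipIf true l2 = l1

-- W = Aut(T), via the wreath recursion g = (g₁ , g₂) σ^b :
-- an element is its portrait, g [] = b (true iff σ occurs) and
-- g (y ∷ w) = (section g₍y₎) w.
W : Set
W = Word → Bool

section : W → Letter → W
section g y w = g (y ∷ w)

-- action on T :  ((g₁,g₂)σ^b)(x w) = y g_y(w),  y = σ^b x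
act : W → Word → Word
act g [] = []
act g (x ∷ w) = flipIf (g []) x ∷ act (section g (flipIf (g []) x)) w

_≈_ : W → W → Set
g ≈ h = ∀ w → g w ≡ h w

e : W
e _ = false

-- composition g ∘ h (h first):
-- (g₁,g₂)σ^a (h₁,h₂)σ^b = (g₁ h_{σ^a 1} , g₂ h_{σ^a 2}) σ^{a+b}
_·_ : W → W → W
(g · h) [] = g [] xor h []
(g · h) (y ∷ w) = (section g y · section h (flipIf (g []) y)) w

-- inverse: ((g₁,g₂)σ^a)⁻¹ = (g_{σ^a 1}⁻¹ , g_{σ^a 2}⁻¹) σ^a
_⁻¹ : W → W
(g ⁻¹) [] = g []
(g ⁻¹) (y ∷ w) = (section g (flipIf (g []) y) ⁻¹) w

-- the generators a₁ = (id, a₃), a₂ = (id, a₁)σ, a₃ = (a₂, id)σ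
a₁ a₂ a₃ : W
a₁ [] = false
a₁ (l1 ∷ w) = false
a₁ (l2 ∷ w) = a₃ w
a₂ [] = true
a₂ (l1 ∷ w) = false
a₂ (l2 ∷ w) = a₁ w
a₃ [] = true
a₃ (l1 ∷ w) = a₂ w
a₃ (l2 ∷ w) = false

data Idx : Set where
  i1 i2 i3 : Idx

a : Idx → W
a i1 = a₁
a i2 = a₂
a i3 = a₃

data Span (S : W → Set) : W → Set where
  base : ∀ {g} → S g → Span S g
  one  : Span S e
  mul  : ∀ {g h} → Span S g → Span S h → Span S (g · h)
  inv  : ∀ {g} → Span S g → Span S (g ⁻¹)
  resp : ∀ {g h} → g ≈ h → Span S g → Span S h

-- W_n = Aut(T_n) by portraits: W₀ trivial, W_{n+1} = (label, section at 1, section at 2)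
Wn : ℕ → Set
Wn zero = ⊤
Wn (suc n) = Bool × Wn n × Wn n

π : (n : ℕ) → W → Wn n
π zero g = tt
π (suc n) g = g [] , π n (section g l1) , π n (section g l2)

pair : ∀ {n} → Wn n → Wn n → Wn (suc n)
pair u v = false , u , v

Γ : W → Set
Γ = Span (λ g → Σ Idx λ i → g ≈ a i)

-- G = closure of Γ in W (basic neighbourhoods of g are the fibres of π_n)
G : W → Set
G g = ∀ n → Σ W λ γ → Γ γ × π n γ ≡ π n g

-- N_i = normal closure in G of ⟨a_i⟩ : generated by the G-conjugates of a_i
N : Idx → W → Set
N i = Span (λ g → Σ W λ h → G h × g ≈ ((h · a i) · (h ⁻¹)))

Nn : Idx → (n : ℕ) → Wn n → Set
Nn i n x = Σ W λ g → N i g × π n g ≡ x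

-- A generator h a₁ h⁻¹ of N₁ (h ∈ G) fixes the first level and, since a₁ = (1, a₃), its two
-- sections are 1 and a G-conjugate of a₃; hence N₁ ⊆ N₃ × N₃ already inside W.  Conversely, every
-- γ ∈ Γ is the second section of some k ∈ Γ fixing the first level (a₁, a₂, a₃ are the second
-- sections of a₂², a₃², a₁).  If γ agrees with h ∈ G up to depth m, then k a₁ k⁻¹ = (1, γ a₃ γ⁻¹)
-- agrees with (1, h a₃ h⁻¹) up to depth m + 1, and conjugating by a₂ k instead gives
-- (γ a₃ γ⁻¹, 1).  As g ↦ (g, 1) and g ↦ (1, g) are homomorphisms, N₃ × N₃ ⊆ N₁ up to depth m + 1.
module Submission where

open import Defs
open import Data.Bool using (true; false; _xor_)
open import Data.Bool.Properties using (xor-identityʳ; xor-same)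
open import Data.List using ([]; _∷_)
open import Data.Nat using (ℕ; zero; suc; _≤_)
open import Data.Product using (Σ; _×_; _,_; proj₁; proj₂)
open import Relation.Binary.PropositionalEquality
  using (_≡_; refl; sym; trans; cong; cong₂)

flipIf-involutive : ∀ b y → flipIf b (flipIf b y) ≡ y
flipIf-involutive false y = refl
flipIf-involutive true l1 = refl
flipIf-involutive true l2 = refl

≈-refl : ∀ {g} → g ≈ g
≈-refl w = refl

≈-sym : ∀ {g h} → g ≈ h → h ≈ g
≈-sym p w = sym (p w)

≈-trans : ∀ {g h k} → g ≈ h → h ≈ k → g ≈ k
≈-trans p q w = trans (p w) (q w)

section-cong : ∀ {g h} → g ≈ h → ∀ y → section g y ≈ section h y
section-cong p y w = p (y ∷ w)

·-cong : ∀ {g g′ h h′} → g ≈ g′ → h ≈ h′ → (g · h) ≈ (g′ · h′)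
·-cong p q [] = cong₂ _xor_ (p []) (q [])
·-cong {g} {g′} {h} p q (y ∷ w) =
  trans (cong (λ b → (section g y · section h (flipIf b y)) w) (p []))
        (·-cong (section-cong p y) (section-cong q (flipIf (g′ []) y)) w)

⁻¹-cong : ∀ {g g′} → g ≈ g′ → (g ⁻¹) ≈ (g′ ⁻¹)
⁻¹-cong p [] = p []
⁻¹-cong {g} {g′} p (y ∷ w) =
  trans (cong (λ b → (section g (flipIf b y) ⁻¹) w) (p []))
        (⁻¹-cong (section-cong p (flipIf (g′ []) y)) w)

·-identityˡ : ∀ g → (e · g) ≈ g
·-identityˡ g [] = refl
·-identityˡ g (y ∷ w) = ·-identityˡ (section g y) w

·-identityʳ : ∀ g → (g · e) ≈ g
·-identityʳ g [] = xor-identityʳ (g [])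
·-identityʳ g (y ∷ w) = ·-identityʳ (section g y) w

·-inverseʳ : ∀ g → (g · (g ⁻¹)) ≈ e
·-inverseʳ g [] = xor-same (g [])
·-inverseʳ g (y ∷ w) =
  trans (cong (λ z → (section g y · (section g z ⁻¹)) w) (flipIf-involutive (g []) y))
        (·-inverseʳ (section g y) w)

⁻¹-identity : (e ⁻¹) ≈ e
⁻¹-identity [] = refl
⁻¹-identity (y ∷ w) = ⁻¹-identity w

conj : W → W → W
conj h g = (h · g) · (h ⁻¹)

conj-identity : ∀ h → conj h e ≈ e
conj-identity h = ≈-trans (·-cong (·-identityʳ h) ≈-refl) (·-inverseʳ h)

conj-cong : ∀ {h h′ g} → h ≈ h′ → conj h g ≈ conj h′ g
conj-cong p = ·-cong (·-cong p ≈-refl) (⁻¹-cong p)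

section-· : ∀ {g h} → g [] ≡ false → ∀ y → section (g · h) y ≈ (section g y · section h y)
section-· g₀ y w rewrite g₀ = refl

section-⁻¹ : ∀ {g} → g [] ≡ false → ∀ y → section (g ⁻¹) y ≈ (section g y ⁻¹)
section-⁻¹ g₀ y w rewrite g₀ = refl

conj-root : ∀ h {g} → g [] ≡ false → conj h g [] ≡ false
conj-root h g₀ rewrite g₀ | xor-identityʳ (h []) = xor-same (h [])

section-conj : ∀ h {g} → g [] ≡ false → ∀ y →
  section (conj h g) y ≈ conj (section h y) (section g (flipIf (h []) y))
section-conj h {g} g₀ y w rewrite g₀ | xor-identityʳ (h []) | flipIf-involutive (h []) y = refl

record IsSubgroup (H : W → Set) : Set where
  field
    ∈-resp : ∀ {g h} → g ≈ h → H g → H h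
    ∈-e    : H e
    ∈-·    : ∀ {g h} → H g → H h → H (g · h)
    ∈-⁻¹   : ∀ {g} → H g → H (g ⁻¹)

Span-isSubgroup : ∀ S → IsSubgroup (Span S)
Span-isSubgroup S = record { ∈-resp = resp ; ∈-e = one ; ∈-· = mul ; ∈-⁻¹ = inv }

Span-minimal : ∀ {S H} → IsSubgroup H → (∀ {g} → S g → H g) → ∀ {g} → Span S g → H g
Span-minimal {S} {H} isH S⊆H = go
  where
  open IsSubgroup isH
  go : ∀ {g} → Span S g → H g
  go (base s) = S⊆H s
  go one = ∈-e
  go (mul x y) = ∈-· (go x) (go y)
  go (inv x) = ∈-⁻¹ (go x)
  go (resp p x) = ∈-resp p (go x)

record IsHomomorphism (φ : W → W) : Set where
  field
    φ-cong : ∀ {g h} → g ≈ h → φ g ≈ φ h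
    φ-e    : φ e ≈ e
    φ-·    : ∀ g h → φ (g · h) ≈ (φ g · φ h)
    φ-⁻¹   : ∀ g → φ (g ⁻¹) ≈ (φ g ⁻¹)

preimage-isSubgroup : ∀ {H φ} → IsSubgroup H → IsHomomorphism φ → IsSubgroup (λ g → H (φ g))
preimage-isSubgroup isH hom = record
  { ∈-resp = λ p → ∈-resp (φ-cong p)
  ; ∈-e = ∈-resp (≈-sym φ-e) ∈-e
  ; ∈-· = λ {g} {h} x y → ∈-resp (≈-sym (φ-· g h)) (∈-· x y)
  ; ∈-⁻¹ = λ {g} x → ∈-resp (≈-sym (φ-⁻¹ g)) (∈-⁻¹ x)
  }
  where
  open IsSubgroup isH
  open IsHomomorphism hom

_⊕_ : W → W → W
(g ⊕ h) [] = false
(g ⊕ h) (l1 ∷ w) = g w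
(g ⊕ h) (l2 ∷ w) = h w

⊕-cong : ∀ {g g′ h h′} → g ≈ g′ → h ≈ h′ → (g ⊕ h) ≈ (g′ ⊕ h′)
⊕-cong p q [] = refl
⊕-cong p q (l1 ∷ w) = p w
⊕-cong p q (l2 ∷ w) = q w

⊕-identity : (e ⊕ e) ≈ e
⊕-identity [] = refl
⊕-identity (l1 ∷ w) = refl
⊕-identity (l2 ∷ w) = refl

⊕-· : ∀ g g′ h h′ → ((g · g′) ⊕ (h · h′)) ≈ ((g ⊕ h) · (g′ ⊕ h′))
⊕-· g g′ h h′ [] = refl
⊕-· g g′ h h′ (l1 ∷ w) = refl
⊕-· g g′ h h′ (l2 ∷ w) = refl

⊕-⁻¹ : ∀ g h → ((g ⁻¹) ⊕ (h ⁻¹)) ≈ ((g ⊕ h) ⁻¹)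
⊕-⁻¹ g h [] = refl
⊕-⁻¹ g h (l1 ∷ w) = refl
⊕-⁻¹ g h (l2 ∷ w) = refl

⊕-sections : ∀ {g} → g [] ≡ false → g ≈ (section g l1 ⊕ section g l2)
⊕-sections g₀ [] = g₀
⊕-sections g₀ (l1 ∷ w) = refl
⊕-sections g₀ (l2 ∷ w) = refl

⊕e-isHomomorphism : IsHomomorphism (_⊕ e)
⊕e-isHomomorphism = record
  { φ-cong = λ p → ⊕-cong p ≈-refl
  ; φ-e = ⊕-identity
  ; φ-· = λ g h → ≈-trans (⊕-cong ≈-refl (≈-sym (·-identityʳ e))) (⊕-· g h e e)
  ; φ-⁻¹ = λ g → ≈-trans (⊕-cong ≈-refl (≈-sym ⁻¹-identity)) (⊕-⁻¹ g e)
  }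

e⊕-isHomomorphism : IsHomomorphism (e ⊕_)
e⊕-isHomomorphism = record
  { φ-cong = ⊕-cong ≈-refl
  ; φ-e = ⊕-identity
  ; φ-· = λ g h → ≈-trans (⊕-cong (≈-sym (·-identityʳ e)) ≈-refl) (⊕-· e e g h)
  ; φ-⁻¹ = λ g → ≈-trans (⊕-cong (≈-sym ⁻¹-identity) ≈-refl) (⊕-⁻¹ e g)
  }

_⊗_ : (W → Set) → (W → Set) → W → Set
(H ⊗ K) g = g [] ≡ false × H (section g l1) × K (section g l2)

⊗-isSubgroup : ∀ {H K} → IsSubgroup H → IsSubgroup K → IsSubgroup (H ⊗ K)
⊗-isSubgroup isH isK = record
  { ∈-resp = λ p (g₀ , x , y) →
      trans (sym (p [])) g₀ , H.∈-resp (section-cong p l1) x , K.∈-resp (section-cong p l2) y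
  ; ∈-e = refl , H.∈-e , K.∈-e
  ; ∈-· = λ {g} {h} (g₀ , x , y) (h₀ , x′ , y′) →
      cong₂ _xor_ g₀ h₀ ,
      H.∈-resp (≈-sym (section-· {g} {h} g₀ l1)) (H.∈-· x x′) ,
      K.∈-resp (≈-sym (section-· {g} {h} g₀ l2)) (K.∈-· y y′)
  ; ∈-⁻¹ = λ {g} (g₀ , x , y) →
      g₀ , H.∈-resp (≈-sym (section-⁻¹ {g} g₀ l1)) (H.∈-⁻¹ x) ,
      K.∈-resp (≈-sym (section-⁻¹ {g} g₀ l2)) (K.∈-⁻¹ y)
  }
  where
  module H = IsSubgroup isH
  module K = IsSubgroup isK

record _≡[_]_ (g : W) (n : ℕ) (h : W) : Set where
  constructor level
  field π-≡ : π n g ≡ π n h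

open _≡[_]_

≡[]-refl : ∀ n {g} → g ≡[ n ] g
≡[]-refl n = level refl

≡[]-trans : ∀ n {g h k} → g ≡[ n ] h → h ≡[ n ] k → g ≡[ n ] k
≡[]-trans n p q = level (trans (π-≡ p) (π-≡ q))

≈⇒≡[] : ∀ n {g h} → g ≈ h → g ≡[ n ] h
≈⇒≡[] zero p = level refl
≈⇒≡[] (suc n) p = level (cong₂ _,_ (p [])
  (cong₂ _,_ (π-≡ (≈⇒≡[] n (section-cong p l1))) (π-≡ (≈⇒≡[] n (section-cong p l2)))))

≡[]-root : ∀ n {g h} → g ≡[ suc n ] h → g [] ≡ h []
≡[]-root n p = cong proj₁ (π-≡ p)

≡[]-section : ∀ n {g h} → g ≡[ suc n ] h → ∀ y → section g y ≡[ n ] section h y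
≡[]-section n p l1 = level (cong (λ t → proj₁ (proj₂ t)) (π-≡ p))
≡[]-section n p l2 = level (cong (λ t → proj₂ (proj₂ t)) (π-≡ p))

≡[]-build : ∀ n {g h} → g [] ≡ h [] → (∀ y → section g y ≡[ n ] section h y) → g ≡[ suc n ] h
≡[]-build n r s = level (cong₂ _,_ r (cong₂ _,_ (π-≡ (s l1)) (π-≡ (s l2))))

·-cong-≡[] : ∀ n {g g′ h h′} → g ≡[ n ] g′ → h ≡[ n ] h′ → (g · h) ≡[ n ] (g′ · h′)
·-cong-≡[] zero p q = level refl
·-cong-≡[] (suc n) {g} {g′} {h} {h′} p q =
  ≡[]-build n (cong₂ _xor_ (≡[]-root n p) (≡[]-root n q)) at
  where
  at : ∀ y → (section g y · section h (flipIf (g []) y)) ≡[ n ] (section g′ y · section h′ (flipIf (g′ []) y))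
  at y rewrite ≡[]-root n p = ·-cong-≡[] n (≡[]-section n p y) (≡[]-section n q (flipIf (g′ []) y))

⁻¹-cong-≡[] : ∀ n {g g′} → g ≡[ n ] g′ → (g ⁻¹) ≡[ n ] (g′ ⁻¹)
⁻¹-cong-≡[] zero p = level refl
⁻¹-cong-≡[] (suc n) {g} {g′} p = ≡[]-build n (≡[]-root n p) at
  where
  at : ∀ y → (section g (flipIf (g []) y) ⁻¹) ≡[ n ] (section g′ (flipIf (g′ []) y) ⁻¹)
  at y rewrite ≡[]-root n p = ⁻¹-cong-≡[] n (≡[]-section n p (flipIf (g′ []) y))

conj-cong-≡[] : ∀ n {h h′} g → h ≡[ n ] h′ → conj h g ≡[ n ] conj h′ g
conj-cong-≡[] n g p = ·-cong-≡[] n (·-cong-≡[] n p (≡[]-refl n)) (⁻¹-cong-≡[] n p)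

⊕-cong-≡[] : ∀ n {g g′ h h′} → g ≡[ n ] g′ → h ≡[ n ] h′ → (g ⊕ h) ≡[ suc n ] (g′ ⊕ h′)
⊕-cong-≡[] n p q = level (cong₂ _,_ refl (cong₂ _,_ (π-≡ p) (π-≡ q)))

Approx : ℕ → (W → Set) → W → Set
Approx n H g = Σ W λ h → H h × h ≡[ n ] g

Approx-isSubgroup : ∀ n {H} → IsSubgroup H → IsSubgroup (Approx n H)
Approx-isSubgroup n isH = record
  { ∈-resp = λ p (h , x , h≡g) → h , x , ≡[]-trans n h≡g (≈⇒≡[] n p)
  ; ∈-e = e , ∈-e , ≡[]-refl n
  ; ∈-· = λ (h , x , h≡g) (h′ , x′ , h′≡g′) → h · h′ , ∈-· x x′ , ·-cong-≡[] n h≡g h′≡g′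
  ; ∈-⁻¹ = λ (h , x , h≡g) → h ⁻¹ , ∈-⁻¹ x , ⁻¹-cong-≡[] n h≡g
  }
  where open IsSubgroup isH

Γ-section : ∀ {g} → Γ g → ∀ y → Γ (section g y)
Γ-section = Span-minimal isSubgroup generator
  where
  isSubgroup : IsSubgroup (λ g → ∀ y → Γ (section g y))
  isSubgroup = record
    { ∈-resp = λ p x y → resp (section-cong p y) (x y)
    ; ∈-e = λ y → one
    ; ∈-· = λ {g} x x′ y → mul (x y) (x′ (flipIf (g []) y))
    ; ∈-⁻¹ = λ {g} x y → inv (x (flipIf (g []) y))
    }
  generator : ∀ {g} → Σ Idx (λ i → g ≈ a i) → ∀ y → Γ (section g y)
  generator (i , p) y = resp (≈-sym (section-cong p y)) (at i y)
    where
    at : ∀ i y → Γ (section (a i) y)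
    at i1 l1 = one
    at i1 l2 = base (i3 , ≈-refl)
    at i2 l1 = one
    at i2 l2 = base (i1 , ≈-refl)
    at i3 l1 = base (i2 , ≈-refl)
    at i3 l2 = one

G-approx : ∀ {h} → G h → ∀ n → Approx n Γ h
G-approx Gh n with Gh n
... | γ , Γγ , γ≡h = γ , Γγ , level γ≡h

G-section : ∀ {h} → G h → ∀ y → G (section h y)
G-section Gh y n with G-approx Gh (suc n)
... | γ , Γγ , γ≡h = section γ y , Γ-section Γγ y , π-≡ (≡[]-section n γ≡h y)

Γ⊆G : ∀ {g} → Γ g → G g
Γ⊆G {g} x n = g , x , refl

-- a₁, a₂, a₃ are the second sections of a₂ a₂, a₃ a₃, a₁, which fix the first level.
Γ-stabiliser-section₂-surjective : ∀ {γ} → Γ γ → Σ W λ k → Γ k × k [] ≡ false × section k l2 ≈ γ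
Γ-stabiliser-section₂-surjective = Span-minimal isSubgroup generator
  where
  isSubgroup : IsSubgroup (λ γ → Σ W λ k → Γ k × k [] ≡ false × section k l2 ≈ γ)
  isSubgroup = record
    { ∈-resp = λ p (k , Γk , k₀ , s) → k , Γk , k₀ , ≈-trans s p
    ; ∈-e = e , one , refl , ≈-refl
    ; ∈-· = λ (k , Γk , k₀ , s) (k′ , Γk′ , k₀′ , s′) →
        k · k′ , mul Γk Γk′ , cong₂ _xor_ k₀ k₀′ ,
        ≈-trans (section-· {k} {k′} k₀ l2) (·-cong s s′)
    ; ∈-⁻¹ = λ (k , Γk , k₀ , s) →
        k ⁻¹ , inv Γk , k₀ , ≈-trans (section-⁻¹ {k} k₀ l2) (⁻¹-cong s)
    }
  generator : ∀ {γ} → Σ Idx (λ i → γ ≈ a i) → Σ W λ k → Γ k × k [] ≡ false × section k l2 ≈ γ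
  generator (i1 , p) = a₂ · a₂ , mul (base (i2 , ≈-refl)) (base (i2 , ≈-refl)) , refl ,
    ≈-trans (·-identityʳ a₁) (≈-sym p)
  generator (i2 , p) = a₃ · a₃ , mul (base (i3 , ≈-refl)) (base (i3 , ≈-refl)) , refl ,
    ≈-trans (·-identityˡ a₂) (≈-sym p)
  generator (i3 , p) = a₁ , base (i1 , ≈-refl) , refl , ≈-sym p

conj-a₁ : ∀ k → conj k a₁ ≈
  (conj (section k l1) (section a₁ (flipIf (k []) l1)) ⊕ conj (section k l2) (section a₁ (flipIf (k []) l2)))
conj-a₁ k = ≈-trans (⊕-sections (conj-root k {a₁} refl))
                    (⊕-cong (section-conj k {a₁} refl l1) (section-conj k {a₁} refl l2))

conj-a₁-stabiliser : ∀ {k} → k [] ≡ false → conj k a₁ ≈ (e ⊕ conj (section k l2) a₃)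
conj-a₁-stabiliser {k} k₀ = ≈-trans (conj-a₁ k) (⊕-cong left right)
  where
  left : conj (section k l1) (section a₁ (flipIf (k []) l1)) ≈ e
  left rewrite k₀ = conj-identity (section k l1)
  right : conj (section k l2) (section a₁ (flipIf (k []) l2)) ≈ conj (section k l2) a₃
  right rewrite k₀ = ≈-refl

conj-a₁-swap : ∀ {k} → k [] ≡ true → conj k a₁ ≈ (conj (section k l1) a₃ ⊕ e)
conj-a₁-swap {k} k₁ = ≈-trans (conj-a₁ k) (⊕-cong left right)
  where
  left : conj (section k l1) (section a₁ (flipIf (k []) l1)) ≈ conj (section k l1) a₃
  left rewrite k₁ = ≈-refl
  right : conj (section k l2) (section a₁ (flipIf (k []) l2)) ≈ e
  right rewrite k₁ = conj-identity (section k l2)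

conj-section-a₁-∈N₃ : ∀ {h} → G h → ∀ z → N i3 (conj h (section a₁ z))
conj-section-a₁-∈N₃ {h} Gh l1 = resp (≈-sym (conj-identity h)) one
conj-section-a₁-∈N₃ {h} Gh l2 = base (h , Gh , ≈-refl)

N₁⊆N₃⊗N₃ : ∀ {g} → N i1 g → (N i3 ⊗ N i3) g
N₁⊆N₃⊗N₃ = Span-minimal (⊗-isSubgroup (Span-isSubgroup _) (Span-isSubgroup _)) generator
  where
  generator : ∀ {g} → Σ W (λ h → G h × g ≈ conj h a₁) → (N i3 ⊗ N i3) g
  generator (h , Gh , p) =
    trans (p []) (conj-root h {a₁} refl) ,
    resp (≈-sym (section-cong p l1)) (at l1) , resp (≈-sym (section-cong p l2)) (at l2)
    where
    at : ∀ y → N i3 (section (conj h a₁) y)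
    at y = resp (≈-sym (section-conj h {a₁} refl y))
                (conj-section-a₁-∈N₃ (G-section Gh y) (flipIf (h []) y))

module _ (m : ℕ) where

  private
    Ñ₁ : W → Set
    Ñ₁ = Approx (suc m) (N i1)

    Ñ₁-isSubgroup : IsSubgroup Ñ₁
    Ñ₁-isSubgroup = Approx-isSubgroup (suc m) (Span-isSubgroup _)

    open IsSubgroup Ñ₁-isSubgroup

  e⊕conj-a₃-∈Ñ₁ : ∀ {h} → G h → Ñ₁ (e ⊕ conj h a₃)
  e⊕conj-a₃-∈Ñ₁ Gh with G-approx Gh m
  ... | γ , Γγ , γ≡h with Γ-stabiliser-section₂-surjective Γγ
  ... | k , Γk , k₀ , s =
    conj k a₁ , base (k , Γ⊆G Γk , ≈-refl) ,
    ≡[]-trans (suc m) (≈⇒≡[] (suc m) (≈-trans (conj-a₁-stabiliser k₀) (⊕-cong ≈-refl (conj-cong s))))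
                      (⊕-cong-≡[] m (≡[]-refl m) (conj-cong-≡[] m a₃ γ≡h))

  conj-a₃⊕e-∈Ñ₁ : ∀ {h} → G h → Ñ₁ (conj h a₃ ⊕ e)
  conj-a₃⊕e-∈Ñ₁ Gh with G-approx Gh m
  ... | γ , Γγ , γ≡h with Γ-stabiliser-section₂-surjective Γγ
  ... | k , Γk , k₀ , s =
    conj σk a₁ , base (σk , Γ⊆G (mul (base (i2 , ≈-refl)) Γk) , ≈-refl) ,
    ≡[]-trans (suc m)
      (≈⇒≡[] (suc m) (≈-trans (conj-a₁-swap (cong (true xor_) k₀)) (⊕-cong (conj-cong s₁) ≈-refl)))
      (⊕-cong-≡[] m (conj-cong-≡[] m a₃ γ≡h) (≡[]-refl m))
    where
    σk : W
    σk = a₂ · k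
    s₁ : section σk l1 ≈ γ
    s₁ = ≈-trans (·-identityˡ (section k l2)) s

  N₃⊕e-∈Ñ₁ : ∀ {g} → N i3 g → Ñ₁ (g ⊕ e)
  N₃⊕e-∈Ñ₁ = Span-minimal (preimage-isSubgroup Ñ₁-isSubgroup ⊕e-isHomomorphism)
    λ (h , Gh , p) → ∈-resp (⊕-cong (≈-sym p) ≈-refl) (conj-a₃⊕e-∈Ñ₁ Gh)

  e⊕N₃-∈Ñ₁ : ∀ {g} → N i3 g → Ñ₁ (e ⊕ g)
  e⊕N₃-∈Ñ₁ = Span-minimal (preimage-isSubgroup Ñ₁-isSubgroup e⊕-isHomomorphism)
    λ (h , Gh , p) → ∈-resp (⊕-cong ≈-refl (≈-sym p)) (e⊕conj-a₃-∈Ñ₁ Gh)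

  N₃⊕N₃-∈Ñ₁ : ∀ {g h} → N i3 g → N i3 h → Ñ₁ (g ⊕ h)
  N₃⊕N₃-∈Ñ₁ {g} {h} x y =
    ∈-resp (≈-trans (≈-sym (⊕-· g e e h)) (⊕-cong (·-identityʳ g) (·-identityˡ h)))
           (∈-· (N₃⊕e-∈Ñ₁ x) (e⊕N₃-∈Ñ₁ y))

lemma7p11 : (m : ℕ) → 1 ≤ m →
    ((x : Wn (suc m)) → Nn i1 (suc m) x →
       Σ (Wn m) λ u → Σ (Wn m) λ v → Nn i3 m u × Nn i3 m v × x ≡ pair u v)
    × ((u v : Wn m) → Nn i3 m u → Nn i3 m v → Nn i1 (suc m) (pair u v))
lemma7p11 m _ = N₁ₙ⊆N₃×N₃ , N₃×N₃⊆N₁ₙ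
  where
  N₁ₙ⊆N₃×N₃ : (x : Wn (suc m)) → Nn i1 (suc m) x →
    Σ (Wn m) λ u → Σ (Wn m) λ v → Nn i3 m u × Nn i3 m v × x ≡ pair u v
  N₁ₙ⊆N₃×N₃ x (g , x′ , refl) with N₁⊆N₃⊗N₃ x′
  ... | g₀ , y₁ , y₂ =
    π m (section g l1) , π m (section g l2) , (section g l1 , y₁ , refl) , (section g l2 , y₂ , refl) ,
    cong (λ b → b , π m (section g l1) , π m (section g l2)) g₀
  N₃×N₃⊆N₁ₙ : (u v : Wn m) → Nn i3 m u → Nn i3 m v → Nn i1 (suc m) (pair u v)
  N₃×N₃⊆N₁ₙ u v (g , y₁ , refl) (h , y₂ , refl) with N₃⊕N₃-∈Ñ₁ m y₁ y₂
  ... | g′ , x′ , g′≡g⊕h = g′ , x′ , π-≡ g′≡g⊕h
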